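{- Let $G$ be a hidden graph on vertex set $V$ accessible via a separation oracle, and let $S\subseteq V$. The connected components of $G[S]$ can be computed with $\mathcal{O}(|S|^2)$ separation queries, and there are instances where $\Omega(|S|^2)$ separation queries are needed.
   Context: The separation oracle, on input $(v,w,U)$ with $v\neq w$ and $U\subseteq V\setminus\{v,w\}$, returns Yes if $v$ and $w$ are in different connected components of the induced subgraph $G[V\setminus U]$, and No otherwise. Computing the connected components of $G[S]$ means outputting the partition of $S$ into the vertex sets of the connected components of $G[S]$, guaranteed correct from the query answers alone. -}

module Defs where

open import Data.Nat using (ℕ; zero; suc; _+_; _*_; _≤_)
open import Data.Bool using (Bool; true; false)
open import Data.Fin using (Fin)
open import Data.Fin.Subset using (Subset; _∈_; _∉_; ∁; ∣_∣)
open import Data.Product using (Σ; ∃; _×_; _,_)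
open import Relation.Binary.PropositionalEquality using (_≡_; _≢_)
open import Relation.Nullary using (¬_)
open import Function.Bundles using (_⇔_)

record Graph (n : ℕ) : Set where
  field
    adj   : Fin n → Fin n → Bool
    sym   : ∀ x y → adj x y ≡ adj y x
    irrefl : ∀ x → adj x x ≡ false
open Graph public

data Conn {n : ℕ} (G : Graph n) (W : Subset n) : Fin n → Fin n → Set where
  here : ∀ {x} → x ∈ W → Conn G W x x
  step : ∀ {x z y} → x ∈ W → adj G x z ≡ true → Conn G W z y → Conn G W x y

Separated : {n : ℕ} → Graph n → Fin n → Fin n → Subset n → Set
Separated G v w U = ¬ Conn G (∁ U) v w

-- An output: a labelling of vertices; the blocks of the partition of S are
-- the sets of vertices of S sharing a label.
Labelling : ℕ → Set
Labelling n = Fin n → ℕ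

CorrectComponents : {n : ℕ} → Graph n → Subset n → Labelling n → Set
CorrectComponents G S o =
  ∀ x y → x ∈ S → y ∈ S → (o x ≡ o y) ⇔ Conn G S x y

-- Deterministic adaptive separation-query algorithms (decision trees).
data Algo (n : ℕ) : Set where
  output : Labelling n → Algo n
  query  : (v w : Fin n) → v ≢ w → (U : Subset n) → v ∉ U → w ∉ U →
           (Bool → Algo n) → Algo n

data Runs {n : ℕ} (G : Graph n) : Algo n → Labelling n → ℕ → Set where
  done : ∀ {o} → Runs G (output o) o zero
  yes  : ∀ {v w p U pv pw k o c} → Separated G v w U →
         Runs G (k true) o c → Runs G (query v w p U pv pw k) o (suc c)
  no   : ∀ {v w p U pv pw k o c} → ¬ Separated G v w U →
         Runs G (k false) o c → Runs G (query v w p U pv pw k) o (suc c)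

Computes : {n : ℕ} → Subset n → Algo n → Set
Computes {n} S A = ∀ (G : Graph n) o c → Runs G A o c → CorrectComponents G S o

WithinQueries : {n : ℕ} → Algo n → ℕ → Set
WithinQueries {n} A B = ∀ (G : Graph n) → ∃ λ o → ∃ λ c → Runs G A o c × c ≤ B

{-# OPTIONS --safe #-}
-- Upper bound: with U = V ∖ S, the query (x, y, U) asks whether x and y lie in different
-- components of G[S]. Asking it for every ordered pair of distinct vertices of S (at most |S|²
-- queries) determines the components, which are then labelled by their least vertex.
--
-- Lower bound: let S be the s leaves of a star with centre 0, and add one edge between leaves
-- a ≠ b. The two graphs answer a query (v, w, U) differently only if {v, w} = {a, b}: if 0 ∉ U
-- both connect everything outside U, and if 0 ∈ U only the edge ab is left. As a and b are in one
-- component of the second graph on S but not of the star, a correct algorithm run on the star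
-- must query every unordered pair of leaves, so s² ≤ 2c + s ≤ 4c for s ≥ 2.
module Submission where

open import Defs hiding (yes; no; sym)
open import Data.Bool using (Bool; true; false; if_then_else_)
import Data.Bool.Properties as Bool
open import Data.Fin using (Fin; zero; suc; toℕ; _≟_)
open import Data.Fin.Properties using (any?; toℕ-injective; suc-injective; +↔⊎; *↔×; injective⇒≤)
open import Data.Fin.Subset using (Subset; _∈_; ∁; ∣_∣; _-_; inside; outside; ⊤)
open import Data.Fin.Subset.Properties
  using (_∈?_; p─q⊆p; x∈p∧x≢y⇒x∈p-y; x∈p⇒∣p-x∣<∣p∣; x∈p⇒x∉∁p; x∈∁p⇒x∉p; x∉∁p⇒x∈p; x∉p⇒x∈∁p; ∈⊤; ∣⊤∣≡n)
open import Data.List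
  using (List; []; _∷_; _++_; length; map; lookup; mapMaybe; cartesianProduct; cartesianProductWith)
open import Data.List.Properties using (length-++; length-map; length-mapMaybe)
open import Data.List.Relation.Unary.All using (All; []; _∷_; all?)
open import Data.List.Relation.Unary.All.Properties using (¬All⇒Any¬)
open import Data.List.Relation.Unary.Any using (Any; here; there; index)
import Data.List.Relation.Unary.Any as Any
open import Data.List.Relation.Unary.Any.Properties
  using (lookup-index; map⁺; mapMaybe⁺; cartesianProductWith⁺)
open import Data.Maybe using (Maybe; just; nothing; maybe)
import Data.Maybe as Maybe
import Data.Maybe.Relation.Unary.Any as MaybeAny
open import Data.Nat using (ℕ; _+_; _*_; _≤_; _<_; _≥_)
open import Data.Nat.Induction using (<-wellFounded)
open import Data.Nat.Properties
  using ( +-identityʳ; *-identityˡ; ≤-reflexive; ≤-trans; +-cancelʳ-≤; +-mono-≤; +-monoʳ-≤; *-monoˡ-≤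
        ; module ≤-Reasoning)
open import Data.Nat.Tactic.RingSolver using (solve-∀)
open import Data.Product using (Σ; ∃; _×_; _,_; proj₁; proj₂; uncurry)
import Data.Product as Product
open import Data.Product.Properties using (≡-dec)
open import Data.Sum using (_⊎_; inj₁; inj₂; [_,_]′)
open import Data.Sum.Function.Propositional using (_⊎-↣_)
open import Data.Sum.Properties using (inj₁-injective; inj₂-injective)
open import Data.Vec using ([]; _∷_; here; there)
open import Function using (_∘_; _on_)
open import Function.Bundles using (_⇔_; mk⇔; Equivalence; _↣_; mk↣; Injection)
open import Function.Construct.Composition using (_↣-∘_)
open import Function.Construct.Identity using (↣-id)
open import Function.Construct.Symmetry using (↔-sym)
open import Function.Definitions using (Injective)
open import Function.Properties.Inverse using (↔⇒↣)
open import Induction.WellFounded using (Acc; acc)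
open import Level using (0ℓ)
open import Relation.Binary.Construct.On using (wellFounded)
open import Relation.Binary.PropositionalEquality
  using (_≡_; _≢_; refl; sym; trans; cong; cong₂; subst; module ≡-Reasoning)
open import Relation.Nullary using (¬_; Dec; yes; no; does; contradiction)
open import Relation.Nullary.Decidable
  using (¬?; _×-dec_; _⊎-dec_; map′; does-⇔; dec-true; dec-false; decidable-stable)
open import Relation.Unary using (Pred; Decidable)

open Equivalence using (to; from)

module _ {n : ℕ} {G : Graph n} where

  conn-head : ∀ {W x y} → Conn G W x y → x ∈ W
  conn-head (here x∈W)     = x∈W
  conn-head (step x∈W _ _) = x∈W

  conn-last : ∀ {W x y} → Conn G W x y → y ∈ W
  conn-last (here y∈W)   = y∈W
  conn-last (step _ _ c) = conn-last c

  conn-trans : ∀ {W x y z} → Conn G W x y → Conn G W y z → Conn G W x z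
  conn-trans (here _)       d = d
  conn-trans (step x∈W e c) d = step x∈W e (conn-trans c d)

  conn-sym : ∀ {W x y} → Conn G W x y → Conn G W y x
  conn-sym (here x∈W) = here x∈W
  conn-sym {x = x} (step {z = z} x∈W e c) =
    conn-trans (conn-sym c) (step (conn-head c) (trans (Graph.sym G z x) e) (here x∈W))

  conn-⊆ : ∀ {W W′ x y} → (∀ {z} → z ∈ W → z ∈ W′) → Conn G W x y → Conn G W′ x y
  conn-⊆ W⊆W′ (here x∈W)     = here (W⊆W′ x∈W)
  conn-⊆ W⊆W′ (step x∈W e c) = step (W⊆W′ x∈W) e (conn-⊆ W⊆W′ c)

  -- Split the walk at its last visit to x.
  last-exit : ∀ {W x y z} → x ≢ y → Conn G W z y →
              Conn G (W - x) z y ⊎ ∃ λ u → adj G x u ≡ true × Conn G (W - x) u y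
  last-exit x≢y (here y∈W) = inj₁ (here (x∈p∧x≢y⇒x∈p-y y∈W (x≢y ∘ sym)))
  last-exit {x = x} x≢y (step {x = z} z∈W e c) with last-exit x≢y c
  ... | inj₂ exit = inj₂ exit
  ... | inj₁ c′ with z ≟ x
  ...   | yes refl = inj₂ (_ , e , c′)
  ...   | no z≢x   = inj₁ (step (x∈p∧x≢y⇒x∈p-y z∈W z≢x) e c′)

  leave-start : ∀ {W x y} → x ≢ y → Conn G W x y → ∃ λ u → adj G x u ≡ true × Conn G (W - x) u y
  leave-start x≢y (here _) = contradiction refl x≢y
  leave-start x≢y (step _ e c) with last-exit x≢y c
  ... | inj₁ c′   = _ , e , c′
  ... | inj₂ exit = exit

  conn-acc? : ∀ {W} → Acc (_<_ on ∣_∣) W → ∀ x y → Dec (Conn G W x y)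
  conn-acc? {W} (acc rec) x y with x ∈? W | x ≟ y
  ... | no x∉W | _        = no (x∉W ∘ conn-head)
  ... | yes x∈W | yes refl = yes (here x∈W)
  ... | yes x∈W | no x≢y   =
    map′ (λ (u , e , c) → step x∈W e (conn-⊆ (p─q⊆p _ _) c)) (leave-start x≢y)
         (any? λ u → adj G x u Bool.≟ true ×-dec conn-acc? (rec (x∈p⇒∣p-x∣<∣p∣ x∈W)) u y)

  conn? : ∀ W x y → Dec (Conn G W x y)
  conn? W = conn-acc? (wellFounded ∣_∣ <-wellFounded W)

Query : ℕ → Set
Query n = Fin n × Fin n × Subset n

module _ {n : ℕ} (G : Graph n) where

  -- Opaque, so that with-abstraction over separated? v w U finds it in goals.
  opaque
    separated? : ∀ v w U → Dec (Separated G v w U)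
    separated? v w U = ¬? (conn? (∁ U) v w)

  answer : Query n → Bool
  answer (v , w , U) = does (separated? v w U)

  answer≡false⇔conn : ∀ {v w U} → answer (v , w , U) ≡ false ⇔ Conn G (∁ U) v w
  answer≡false⇔conn {v} {w} {U} with separated? v w U
  ... | yes sep = mk⇔ (λ ()) (λ c → contradiction c sep)
  ... | no ¬sep = mk⇔ (λ _ → decidable-stable (conn? (∁ U) v w) ¬sep) (λ _ → refl)

  outcome : Algo n → Labelling n
  outcome (output o)            = o
  outcome (query v w _ U _ _ k) = outcome (k (answer (v , w , U)))

  trace : Algo n → List (Query n)
  trace (output _)            = []
  trace (query v w _ U _ _ k) = (v , w , U) ∷ trace (k (answer (v , w , U)))

  runs-outcome : ∀ A → Runs G A (outcome A) (length (trace A))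
  runs-outcome (output o) = done
  runs-outcome (query v w _ U _ _ k) with separated? v w U
  ... | yes sep = Runs.yes sep (runs-outcome (k true))
  ... | no ¬sep = Runs.no ¬sep (runs-outcome (k false))

  runs-unique : ∀ {A o c} → Runs G A o c → o ≡ outcome A × c ≡ length (trace A)
  runs-unique done = refl , refl
  runs-unique (Runs.yes {v = v} {w} {U = U} {k = k} sep r)
    rewrite dec-true (separated? v w U) sep with runs-unique r
  ... | refl , refl = refl , refl
  runs-unique (Runs.no {v = v} {w} {U = U} {k = k} ¬sep r)
    rewrite dec-false (separated? v w U) ¬sep with runs-unique r
  ... | refl , refl = refl , refl

outcome-cong : ∀ {n} {G H : Graph n} A →
               All (λ q → answer G q ≡ answer H q) (trace G A) → outcome G A ≡ outcome H A
outcome-cong (output o) [] = refl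
outcome-cong {H = H} (query v w _ U _ _ k) (same ∷ rest) =
  trans (outcome-cong (k _) rest) (cong (outcome H ∘ k) same)

first : ∀ {n} {P : Pred (Fin n) 0ℓ} → Decidable P → Maybe (Fin n)
first {ℕ.zero} P? = nothing
first {ℕ.suc n} P? = if does (P? zero) then just zero else Maybe.map suc (first (P? ∘ suc))

first-just : ∀ {n} {P : Pred (Fin n) 0ℓ} (P? : Decidable P) {i} → P i → ∃ λ j → first P? ≡ just j × P j
first-just P? {zero} p with P? zero
... | yes _  = zero , refl , p
... | no ¬p  = contradiction p ¬p
first-just P? {suc i} p with P? zero
... | yes p₀ = zero , refl , p₀
... | no _ with first-just (P? ∘ suc) p
...   | j , found , pj = suc j , cong (Maybe.map suc) found , pj

first-cong : ∀ {n} {P Q : Pred (Fin n) 0ℓ} (P? : Decidable P) (Q? : Decidable Q) →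
             (∀ i → P i ⇔ Q i) → first P? ≡ first Q?
first-cong {ℕ.zero} _ _ _ = refl
first-cong {ℕ.suc n} P? Q? P⇔Q rewrite does-⇔ (P⇔Q zero) (P? zero) (Q? zero) =
  cong (λ m → if does (Q? zero) then just zero else Maybe.map suc m)
       (first-cong (P? ∘ suc) (Q? ∘ suc) (P⇔Q ∘ suc))

classLabel : ∀ {n} {R : Fin n → Fin n → Set} → (∀ x y → Dec (R x y)) → Labelling n
classLabel R? x = maybe toℕ 0 (first (R? x))

classLabel-correct : ∀ {n} {G : Graph n} {S : Subset n} {R : Fin n → Fin n → Set}
                     (R? : ∀ x y → Dec (R x y)) → (∀ {x y} → x ∈ S → R x y ⇔ Conn G S x y) →
                     CorrectComponents G S (classLabel R?)
classLabel-correct {G = G} {S} R? R⇔Conn x y x∈S y∈S = mk⇔ same⇒conn conn⇒same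
  where
  representative : ∀ {z} → z ∈ S → ∃ λ r → classLabel R? z ≡ toℕ r × Conn G S z r
  representative z∈S with first-just (R? _) (from (R⇔Conn z∈S) (here z∈S))
  ... | r , found , Rzr = r , cong (maybe toℕ 0) found , to (R⇔Conn z∈S) Rzr

  same⇒conn : classLabel R? x ≡ classLabel R? y → Conn G S x y
  same⇒conn same with representative x∈S | representative y∈S
  ... | r , x↦r , x~r | r′ , y↦r′ , y~r′ with toℕ-injective (trans (sym x↦r) (trans same y↦r′))
  ...   | refl = conn-trans x~r (conn-sym y~r′)

  conn⇒same : Conn G S x y → classLabel R? x ≡ classLabel R? y
  conn⇒same x~y = cong (maybe toℕ 0) (first-cong (R? x) (R? y) λ z → mk⇔
    (λ Rxz → from (R⇔Conn y∈S) (conn-trans (conn-sym x~y) (to (R⇔Conn x∈S) Rxz)))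
    (λ Ryz → from (R⇔Conn x∈S) (conn-trans x~y (to (R⇔Conn y∈S) Ryz))))

-- Upper bound

length-cartesianProductWith : ∀ {A B C : Set} (f : A → B → C) xs ys →
                              length (cartesianProductWith f xs ys) ≡ length xs * length ys
length-cartesianProductWith f []       ys = refl
length-cartesianProductWith f (x ∷ xs) ys = begin
  length (map (f x) ys ++ cartesianProductWith f xs ys)
    ≡⟨ length-++ (map (f x) ys) ⟩
  length (map (f x) ys) + length (cartesianProductWith f xs ys)
    ≡⟨ cong₂ _+_ (length-map (f x) ys) (length-cartesianProductWith f xs ys) ⟩
  length ys + length xs * length ys
    ∎
  where open ≡-Reasoning

members : ∀ {n} (S : Subset n) → List (Σ (Fin n) (_∈ S))
members []            = []
members (inside  ∷ S) = (zero , here) ∷ map (Product.map suc there) (members S)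
members (outside ∷ S) = map (Product.map suc there) (members S)

length-members : ∀ {n} (S : Subset n) → length (members S) ≡ ∣ S ∣
length-members []            = refl
length-members (inside  ∷ S) = cong ℕ.suc (trans (length-map _ (members S)) (length-members S))
length-members (outside ∷ S) = trans (length-map _ (members S)) (length-members S)

members-complete : ∀ {n} {S : Subset n} {x} → x ∈ S → Any ((x ≡_) ∘ proj₁) (members S)
members-complete {S = inside  ∷ S} here        = here refl
members-complete {S = inside  ∷ S} (there x∈S) = there (map⁺ (Any.map (cong suc) (members-complete x∈S)))
members-complete {S = outside ∷ S} (there x∈S) = map⁺ (Any.map (cong suc) (members-complete x∈S))

module Components {n : ℕ} (S : Subset n) where

  record Probe : Set where
    field
      v w : Fin n
      v≢w : v ≢ w
      v∈S : v ∈ S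
      w∈S : w ∈ S
  open Probe

  ends : Probe → Fin n × Fin n
  ends p = v p , w p

  toProbe : Σ (Fin n) (_∈ S) → Σ (Fin n) (_∈ S) → Maybe Probe
  toProbe (x , x∈S) (y , y∈S) with x ≟ y
  ... | yes _   = nothing
  ... | no x≢y = just record { v = x ; w = y ; v≢w = x≢y ; v∈S = x∈S ; w∈S = y∈S }

  probes : List Probe
  probes = mapMaybe (uncurry toProbe) (cartesianProduct (members S) (members S))

  length-probes : length probes ≤ ∣ S ∣ * ∣ S ∣
  length-probes = begin
    length probes                     ≤⟨ length-mapMaybe _ (cartesianProduct ms ms) ⟩
    length (cartesianProduct ms ms)   ≡⟨ length-cartesianProductWith _,_ ms ms ⟩
    length ms * length ms             ≡⟨ cong₂ _*_ (length-members S) (length-members S) ⟩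
    ∣ S ∣ * ∣ S ∣                      ∎
    where
    open ≤-Reasoning
    ms : List (Σ (Fin n) (_∈ S))
    ms = members S

  probes-complete : ∀ {x y} → x ∈ S → y ∈ S → x ≢ y → Any (((x , y) ≡_) ∘ ends) probes
  probes-complete {x} {y} x∈S y∈S x≢y =
    mapMaybe⁺ (uncurry toProbe) _
      (map⁺ (cartesianProductWith⁺ _,_ probed (members-complete x∈S) (members-complete y∈S)))
    where
    probed : ∀ {m m′} → x ≡ proj₁ m → y ≡ proj₁ m′ → MaybeAny.Any (((x , y) ≡_) ∘ ends) (toProbe m m′)
    probed refl refl with x ≟ y
    ... | yes x≡y = contradiction x≡y x≢y
    ... | no _    = MaybeAny.just refl

  Table : Set
  Table = Fin n × Fin n → Bool

  _[_]≔_ : Table → Fin n × Fin n → Bool → Table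
  (t [ e ]≔ b) e′ = if does (≡-dec _≟_ _≟_ e′ e) then b else t e′

  collect : List Probe → (Table → Algo n) → Algo n
  collect []       k = k (λ _ → true)
  collect (p ∷ ps) k = query (v p) (w p) (v≢w p) (∁ S) (x∈p⇒x∉∁p (v∈S p)) (x∈p⇒x∉∁p (w∈S p))
                             λ b → collect ps (λ t → k (t [ ends p ]≔ b))

  -- Entries of a table are meaningful only for probed pairs, i.e. distinct vertices of S.
  Linked : Table → Fin n → Fin n → Set
  Linked t x y = y ∈ S × (x ≡ y ⊎ t (x , y) ≡ false)

  linked? : (t : Table) → ∀ x y → Dec (Linked t x y)
  linked? t x y = y ∈? S ×-dec (x ≟ y ⊎-dec t (x , y) Bool.≟ false)

  algorithm : Algo n
  algorithm = collect probes (output ∘ classLabel ∘ linked?)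

  module _ (G : Graph n) where

    answers : List Probe → Table
    answers []       = λ _ → true
    answers (p ∷ ps) = answers ps [ ends p ]≔ answer G (v p , w p , ∁ S)

    outcome-collect : ∀ ps k → outcome G (collect ps k) ≡ outcome G (k (answers ps))
    outcome-collect []       k = refl
    outcome-collect (p ∷ ps) k = outcome-collect ps _

    length-trace-collect : ∀ ps k →
                           length (trace G (collect ps k)) ≡ length ps + length (trace G (k (answers ps)))
    length-trace-collect []       k = refl
    length-trace-collect (p ∷ ps) k = cong ℕ.suc (length-trace-collect ps _)

    answers-probed : ∀ ps {x y} → Any (((x , y) ≡_) ∘ ends) ps →
                     answers ps (x , y) ≡ answer G (x , y , ∁ S)
    answers-probed (p ∷ ps) {x} {y} probed with ≡-dec _≟_ _≟_ (x , y) (ends p)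
    ... | yes refl = refl
    ... | no ≢p    = answers-probed ps (Any.tail ≢p probed)

    linked⇔conn : ∀ {x y} → x ∈ S → Linked (answers probes) x y ⇔ Conn G S x y
    linked⇔conn {x} {y} x∈S with x ≟ y
    ... | yes refl = mk⇔ (λ _ → here x∈S) (λ c → conn-last c , inj₁ refl)
    ... | no x≢y   = mk⇔ linked⇒conn conn⇒linked
      where
      answered : y ∈ S → answers probes (x , y) ≡ answer G (x , y , ∁ S)
      answered y∈S = answers-probed probes (probes-complete x∈S y∈S x≢y)

      linked⇒conn : Linked (answers probes) x y → Conn G S x y
      linked⇒conn (_   , inj₁ x≡y)     = contradiction x≡y x≢y
      linked⇒conn (y∈S , inj₂ said-no) =
        conn-⊆ (x∉∁p⇒x∈p ∘ x∈∁p⇒x∉p) (to (answer≡false⇔conn G) (trans (sym (answered y∈S)) said-no))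

      conn⇒linked : Conn G S x y → Linked (answers probes) x y
      conn⇒linked c = conn-last c ,
        inj₂ (trans (answered (conn-last c))
                    (from (answer≡false⇔conn G) (conn-⊆ (x∉p⇒x∈∁p ∘ x∈p⇒x∉∁p) c)))

  algorithm-computes : Computes S algorithm
  algorithm-computes G o c run rewrite proj₁ (runs-unique G run)
                                     | outcome-collect G probes (output ∘ classLabel ∘ linked?) =
    classLabel-correct (linked? (answers G probes)) (linked⇔conn G)

  algorithm-within : WithinQueries algorithm (∣ S ∣ * ∣ S ∣)
  algorithm-within G = outcome G algorithm , length (trace G algorithm) , runs-outcome G algorithm , cost
    where
    open ≤-Reasoning
    cost : length (trace G algorithm) ≤ ∣ S ∣ * ∣ S ∣
    cost = begin
      length (trace G algorithm) ≡⟨ length-trace-collect G probes (output ∘ classLabel ∘ linked?) ⟩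
      length probes + 0          ≡⟨ +-identityʳ _ ⟩
      length probes              ≤⟨ length-probes ⟩
      ∣ S ∣ * ∣ S ∣               ∎

-- Counting the pairs joined by a list of queries

Joins : {B : Set} → B → B → B × B → Set
Joins u v e = e ≡ (u , v) ⊎ e ≡ (v , u)

joins? : ∀ {n} (u v : Fin n) e → Dec (Joins u v e)
joins? u v e = ≡-dec _≟_ _≟_ e (u , v) ⊎-dec ≡-dec _≟_ _≟_ e (v , u)

joined-pairs-bound : ∀ {B : Set} {m} {f : Fin m → B} → Injective _≡_ _≡_ f → (L : List (B × B)) →
                     (∀ {a b} → a ≢ b → Any (Joins (f a) (f b)) L) → m * m ≤ length L * 2 + m
joined-pairs-bound {m = m} {f} f-injective L joined = injective⇒≤ (Injection.injective counting)
  where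
  orientation : ∀ {u v e} → Joins u v e → Fin 2
  orientation (inj₁ _) = zero
  orientation (inj₂ _) = suc zero

  encode : Fin m × Fin m → (Fin (length L) × Fin 2) ⊎ Fin m
  encode (a , b) with a ≟ b
  ... | yes _   = inj₂ a
  ... | no a≢b = inj₁ (index (joined a≢b) , orientation (lookup-index (joined a≢b)))

  f²-injective : ∀ {a b a′ b′} → (f a , f b) ≡ (f a′ , f b′) → (a , b) ≡ (a′ , b′)
  f²-injective eq = cong₂ _,_ (f-injective (cong proj₁ eq)) (f-injective (cong proj₂ eq))

  same-edge : ∀ {a b a′ b′ e e′} → e ≡ e′ → (j : Joins (f a) (f b) e) (j′ : Joins (f a′) (f b′) e′) →
              orientation j ≡ orientation j′ → (a , b) ≡ (a′ , b′)
  same-edge refl (inj₁ refl) (inj₁ eq) _ = f²-injective eq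
  same-edge refl (inj₂ refl) (inj₂ eq) _ = cong (λ (b , a) → a , b) (f²-injective eq)

  encode-injective : Injective _≡_ _≡_ encode
  encode-injective {a , b} {a′ , b′} eq with a ≟ b | a′ ≟ b′
  ... | yes refl | yes refl = cong (λ a → a , a) (inj₂-injective eq)
  ... | no a≢b   | no a′≢b′ =
    same-edge (cong (lookup L ∘ proj₁) (inj₁-injective eq))
              (lookup-index (joined a≢b)) (lookup-index (joined a′≢b′)) (cong proj₂ (inj₁-injective eq))

  counting : Fin (m * m) ↣ Fin (length L * 2 + m)
  counting = ↔⇒↣ (↔-sym +↔⊎) ↣-∘ ((↔⇒↣ (↔-sym *↔×) ⊎-↣ ↣-id _) ↣-∘ (mk↣ encode-injective ↣-∘ ↔⇒↣ *↔×))

-- Lower bound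

edgeless : ∀ {n} → Graph n
edgeless = record { adj = λ _ _ → false ; sym = λ _ _ → refl ; irrefl = λ _ → refl }

edgeless-conn : ∀ {n W} {x y : Fin n} → Conn edgeless W x y → x ≡ y
edgeless-conn (here _) = refl

edge : ∀ {n} (a b : Fin n) → a ≢ b → Graph n
edge a b a≢b = record
  { adj    = λ x y → does (joins? a b (x , y))
  ; sym    = λ x y → does-⇔ (mk⇔ swap swap) (joins? a b (x , y)) (joins? a b (y , x))
  ; irrefl = λ x → dec-false (joins? a b (x , x)) (a≢b ∘ diagonal)
  }
  where
  diagonal : ∀ {x} → Joins a b (x , x) → a ≡ b
  diagonal (inj₁ refl) = refl
  diagonal (inj₂ refl) = refl

  swap : ∀ {x y} → Joins a b (x , y) → Joins a b (y , x)
  swap (inj₁ refl) = inj₂ refl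
  swap (inj₂ refl) = inj₁ refl

does⇒ : ∀ {A : Set} (a? : Dec A) → does a? ≡ true → A
does⇒ (yes a) _ = a

edge-conn : ∀ {n W} {a b x y : Fin n} {a≢b : a ≢ b} →
            Conn (edge a b a≢b) W x y → x ≡ y ⊎ Joins a b (x , y)
edge-conn (here _) = inj₁ refl
edge-conn {a = a} {b} {a≢b = a≢b} (step {x = x} {z} _ x~z c)
  with does⇒ (joins? a b (x , z)) x~z | edge-conn {a≢b = a≢b} c
... | j         | inj₁ refl        = inj₂ j
... | inj₁ refl | inj₂ (inj₁ refl) = inj₂ (inj₁ refl)
... | inj₁ refl | inj₂ (inj₂ refl) = inj₁ refl
... | inj₂ refl | inj₂ (inj₁ refl) = inj₁ refl
... | inj₂ refl | inj₂ (inj₂ refl) = inj₂ (inj₂ refl)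

cone : ∀ {n} → Graph n → Graph (ℕ.suc n)
cone {n} H = record { adj = adjᶜ ; sym = symᶜ ; irrefl = irreflᶜ }
  where
  adjᶜ : Fin (ℕ.suc n) → Fin (ℕ.suc n) → Bool
  adjᶜ zero    zero    = false
  adjᶜ zero    (suc _) = true
  adjᶜ (suc _) zero    = true
  adjᶜ (suc x) (suc y) = adj H x y

  symᶜ : ∀ x y → adjᶜ x y ≡ adjᶜ y x
  symᶜ zero    zero    = refl
  symᶜ zero    (suc _) = refl
  symᶜ (suc _) zero    = refl
  symᶜ (suc x) (suc y) = Graph.sym H x y

  irreflᶜ : ∀ x → adjᶜ x x ≡ false
  irreflᶜ zero    = refl
  irreflᶜ (suc x) = irrefl H x

module _ {n : ℕ} {H : Graph n} where

  cone-apex : ∀ {W v w} → zero ∈ W → v ∈ W → w ∈ W → Conn (cone H) W v w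
  cone-apex {v = zero}  {zero}  _   v∈W w∈W = here v∈W
  cone-apex {v = zero}  {suc _} _   v∈W w∈W = step v∈W refl (here w∈W)
  cone-apex {v = suc _} {zero}  _   v∈W w∈W = step v∈W refl (here w∈W)
  cone-apex {v = suc _} {suc _} 0∈W v∈W w∈W = step v∈W refl (step 0∈W refl (here w∈W))

  cone-base : ∀ {W x y} → Conn (cone H) (outside ∷ W) (suc x) (suc y) → Conn H W x y
  cone-base (here (there y∈W)) = here y∈W
  cone-base (step {z = zero}  _           _   c) = contradiction (conn-head c) λ ()
  cone-base (step {z = suc _} (there x∈W) x~z c) = step x∈W x~z (cone-base c)

  cone-lift : ∀ {b W x y} → Conn H W x y → Conn (cone H) (b ∷ W) (suc x) (suc y)
  cone-lift (here y∈W)       = here (there y∈W)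
  cone-lift (step x∈W x~z c) = step (there x∈W) x~z (cone-lift c)

cone-conn-transfer : ∀ {n} {H H′ : Graph n} {W v w} →
                     (∀ {x y W} → v ≡ suc x → w ≡ suc y → Conn H W x y → Conn H′ W x y) →
                     Conn (cone H) W v w → Conn (cone H′) W v w
cone-conn-transfer {W = inside  ∷ _}                   _ c = cone-apex here (conn-head c) (conn-last c)
cone-conn-transfer {W = outside ∷ _} {zero}            _ c = contradiction (conn-head c) λ ()
cone-conn-transfer {W = outside ∷ _} {suc _} {zero}    _ c = contradiction (conn-last c) λ ()
cone-conn-transfer {W = outside ∷ _} {suc _} {suc _} base c = cone-lift (base refl refl (cone-base c))

endpoints : ∀ {n} → Query n → Fin n × Fin n
endpoints (v , w , _) = v , w

module LowerBound (s : ℕ) where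

  leaves : Subset (ℕ.suc s)
  leaves = outside ∷ ⊤

  star : Graph (ℕ.suc s)
  star = cone edgeless

  module _ {a b : Fin s} (a≢b : a ≢ b) where

    star+ : Graph (ℕ.suc s)
    star+ = cone (edge a b a≢b)

    star⇒star+ : ∀ {W v w} → Conn star W v w → Conn star+ W v w
    star⇒star+ = cone-conn-transfer λ _ _ c →
      subst (Conn _ _ _) (edgeless-conn c) (here (conn-head c))

    star+⇒star : ∀ {W v w} → ¬ Joins (suc a) (suc b) (v , w) → Conn star+ W v w → Conn star W v w
    star+⇒star ¬joins = cone-conn-transfer λ { refl refl c →
      [ (λ x≡y → subst (Conn _ _ _) x≡y (here (conn-head c)))
      , (λ j → contradiction (suc-joins j) ¬joins)
      ]′ (edge-conn {a≢b = a≢b} c) }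
      where
      suc-joins : ∀ {x y} → Joins a b (x , y) → Joins (suc a) (suc b) (suc x , suc y)
      suc-joins (inj₁ refl) = inj₁ refl
      suc-joins (inj₂ refl) = inj₂ refl

    separations-agree : ∀ {v w U} → ¬ Joins (suc a) (suc b) (v , w) →
                        Separated star v w U ⇔ Separated star+ v w U
    separations-agree ¬joins = mk⇔ (λ sep c → sep (star+⇒star ¬joins c)) (λ sep c → sep (star⇒star+ c))

    disagreement⇒joins : ∀ {q} → answer star q ≢ answer star+ q → Joins (suc a) (suc b) (endpoints q)
    disagreement⇒joins {v , w , U} differ with joins? (suc a) (suc b) (v , w)
    ... | yes j  = j
    ... | no ¬j = contradiction (does-⇔ (separations-agree ¬j) (separated? star v w U) (separated? star+ v w U))
                                differ

    agree? : ∀ q → Dec (answer star q ≡ answer star+ q)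
    agree? q = answer star q Bool.≟ answer star+ q

    queries-join : ∀ {A} → Computes leaves A → Any (Joins (suc a) (suc b)) (map endpoints (trace star A))
    queries-join {A} computes with all? agree? (trace star A)
    ... | no disagree = map⁺ (Any.map disagreement⇒joins (¬All⇒Any¬ agree? _ disagree))
    ... | yes agree   = contradiction (edgeless-conn (cone-base joined-in-star)) a≢b
      where
      same-label : outcome star A (suc a) ≡ outcome star A (suc b)
      same-label rewrite outcome-cong A agree =
        from (computes star+ _ _ (runs-outcome star+ A) (suc a) (suc b) (there ∈⊤) (there ∈⊤))
             (cone-lift (step ∈⊤ (dec-true (joins? a b (a , b)) (inj₁ refl)) (here ∈⊤)))

      joined-in-star : Conn star leaves (suc a) (suc b)
      joined-in-star =
        to (computes star _ _ (runs-outcome star A) (suc a) (suc b) (there ∈⊤) (there ∈⊤)) same-label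

  lower-bound : ∀ {A o c} → Computes leaves A → Runs star A o c → s * s ≤ c * 2 + s
  lower-bound {A} computes run rewrite proj₂ (runs-unique star run) =
    subst (λ ℓ → s * s ≤ ℓ * 2 + s) (length-map endpoints (trace star A))
          (joined-pairs-bound suc-injective (map endpoints (trace star A))
                              (λ a≢b → queries-join a≢b computes))

s*s≤c*2+s⇒s*s≤4*c : ∀ {s c} → 2 ≤ s → s * s ≤ c * 2 + s → s * s ≤ 4 * c
s*s≤c*2+s⇒s*s≤4*c {s} {c} 2≤s s²≤2c+s = +-cancelʳ-≤ (s * s) (s * s) (4 * c) (begin
  s * s + s * s             ≤⟨ +-mono-≤ s²≤2c+s s²≤2c+s ⟩
  (c * 2 + s) + (c * 2 + s) ≡⟨ regroup c s ⟩
  4 * c + 2 * s             ≤⟨ +-monoʳ-≤ (4 * c) (*-monoˡ-≤ s 2≤s) ⟩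
  4 * c + s * s             ∎)
  where
  open ≤-Reasoning
  regroup : ∀ c s → (c * 2 + s) + (c * 2 + s) ≡ 4 * c + 2 * s
  regroup = solve-∀

within-mono : ∀ {n} {A : Algo n} {B B′} → WithinQueries A B → B ≤ B′ → WithinQueries A B′
within-mono within B≤B′ G with within G
... | o , c , run , c≤B = o , c , run , ≤-trans c≤B B≤B′

theorem18 : (∃ λ (C : ℕ) → ∀ (n : ℕ) (S : Subset n) →
    ∃ λ (A : Algo n) → Computes S A × WithinQueries A (C * (∣ S ∣ * ∣ S ∣)))
    ×
    (∃ λ (d : ℕ) → ∃ λ (s₀ : ℕ) → ∀ (s : ℕ) → s ≥ s₀ →
    ∃ λ (n : ℕ) → ∃ λ (S : Subset n) → (∣ S ∣ ≡ s) ×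
    (∀ (A : Algo n) → Computes S A →
    ∃ λ (G : Graph n) → ∀ o c → Runs G A o c → s * s ≤ d * c))
theorem18 = (1 , upper) , (4 , 2 , lower)
  where
  upper : ∀ n (S : Subset n) → ∃ λ (A : Algo n) → Computes S A × WithinQueries A (1 * (∣ S ∣ * ∣ S ∣))
  upper n S =
    algorithm , algorithm-computes , within-mono algorithm-within (≤-reflexive (sym (*-identityˡ _)))
    where open Components S

  lower : ∀ s → s ≥ 2 → ∃ λ n → ∃ λ (S : Subset n) → (∣ S ∣ ≡ s) ×
          (∀ (A : Algo n) → Computes S A → ∃ λ (G : Graph n) → ∀ o c → Runs G A o c → s * s ≤ 4 * c)
  lower s 2≤s = ℕ.suc s , leaves , ∣⊤∣≡n s , λ A computes →
    star , λ o c run → s*s≤c*2+s⇒s*s≤4*c {c = c} 2≤s (lower-bound computes run)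
    where open LowerBound s
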